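{- Let $\nu_2(D)$ denote the number of partitions of a positive integer $D$ using exactly two types of parts, $\sigma(D)$ denote the sum of divisors of $D$, and $\tau(D)$ denote the number of divisors of $D$. Then $$h(D)=\nu_2(D)+2\sigma(D)-\tau(D).$$
   Context: A positive linear fractional transformation (PLFT) is a function $f(z)=\frac{az+b}{cz+d}$ with $a,b,c,d$ nonnegative integers and $ad-bc\neq 0$; its determinant is $ad-bc$. The PLFTs are arranged in Calkin-Wilf trees, in which the left child of $f(z)$ is $f(z)/(f(z)+1)$ and the right child is $f(z)+1$. An orphan is a PLFT which is not the left or right child of any PLFT; these are exactly the PLFTs $\frac{az+b}{cz+d}$ with either $a<c$ and $b>d$, or $a>c$ and $b<d$. For a positive integer $D$, $h(D)$ denotes the number of orphan PLFTs with determinant $D$ (one has $h(D)=h(-D)$). Equivalently, $h(D)=\sum_{b,c\geq 0,\ b+c<D}\ \#\{(a,d): a>c,\ d>b,\ ad=D+bc\}$. -}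

module Defs where

open import Data.Nat using (ℕ; zero; suc; _+_; _*_; _<_; _>_; _<?_)
open import Data.Nat.Divisibility using (_∣_; _∣?_)
open import Data.Nat.Properties using (_≟_)
open import Data.List using (List; []; _∷_; map; upTo; filter; length; concatMap)
open import Data.Nat.ListAction using (sum)
open import Data.Product using (_×_; _,_)
open import Data.Sum using (_⊎_)
open import Relation.Binary.PropositionalEquality using (_≡_)
open import Relation.Nullary.Decidable using (_×-dec_; _⊎-dec_)

divisors : ℕ → List ℕ
divisors D = filter (λ d → d ∣? D) (map suc (upTo D))

σ : ℕ → ℕ
σ D = sum (divisors D)

τ : ℕ → ℕ
τ D = length (divisors D)

Quad : Set
Quad = ℕ × ℕ × ℕ × ℕ

quads : ℕ → List Quad
quads N = concatMap (λ x → concatMap (λ y → concatMap (λ z →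
            map (λ w → (x , y , z , w)) (upTo N)) (upTo N)) (upTo N)) (upTo N)

-- A PLFT (az+b)/(cz+d), a,b,c,d ∈ ℕ, is an orphan iff
-- (a < c and b > d) or (a > c and b < d).
IsOrphan : Quad → Set
IsOrphan (a , b , c , d) = (a < c × b > d) ⊎ (a > c × b < d)

HasDet : ℕ → Quad → Set
HasDet D (a , b , c , d) = a * d ≡ D + b * c

OrphanWithDet : ℕ → Quad → Set
OrphanWithDet D q = IsOrphan q × HasDet D q

orphanWithDet? : ∀ D q → Relation.Nullary.Decidable.Dec (OrphanWithDet D q)
orphanWithDet? D (a , b , c , d) =
  ((a <? c ×-dec d <? b) ⊎-dec (c <? a ×-dec b <? d)) ×-dec (a * d ≟ D + b * c)

-- Every such orphan has a,b,c,d ≤ D + D*D (indeed b + c < D and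
-- a, d ≤ D + b*c), so counting inside the box [0, D*D + D] is exhaustive.
h : ℕ → ℕ
h D = length (filter (orphanWithDet? D) (quads (suc (D + D * D))))

-- ν₂(D): number of partitions of D using exactly two distinct part sizes.
-- Such a partition is p^m q^n with part sizes p > q ≥ 1 and
-- multiplicities m, n ≥ 1, m*p + n*q = D; it is determined by (p, q, m, n).
TwoTypePartition : ℕ → Quad → Set
TwoTypePartition D (p , q , m , n) =
  (q > 0 × p > q) × (m > 0 × n > 0) × (m * p + n * q ≡ D)

twoTypePartition? : ∀ D t → Relation.Nullary.Decidable.Dec (TwoTypePartition D t)
twoTypePartition? D (p , q , m , n) =
  (0 <? q ×-dec q <? p) ×-dec (0 <? m ×-dec 0 <? n) ×-dec (m * p + n * q ≟ D)

ν₂ : ℕ → ℕ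
ν₂ D = length (filter (twoTypePartition? D) (quads (suc D)))

{-# OPTIONS --safe #-}
module Submission where

-- An orphan of positive determinant D has a > c and b < d (the other kind has ad < bc),
-- and then (c + 1)(b + 1) ≤ ad = D + bc forces b + c < D.  Such orphans with b = 0 are
-- (a, 0, c, D/a) with a ∣ D and c < a, so there are σ(D) of them; the symmetry
-- (a, b, c, d) ↦ (d, c, b, a) gives σ(D) with c = 0, of which the τ(D) orphans
-- (a, 0, 0, D/a) also have b = 0.  Those with b, c > 0 correspond to the partitions
-- D = (a − c)·d + c·(d − b) into a − c parts d and c parts d − b.
-- Hence h(D) = σ(D) + (σ(D) − τ(D)) + ν₂(D).

open import Defs
open import Data.List
  using (List; []; _∷_; map; filter; length; concatMap; upTo; cartesianProduct; _++_)
open import Data.List.Properties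
  using (length-map; length-++; length-upTo; map-++; map-∘; map-id; map-id-local; map-cong; concatMap-cong)
open import Data.List.Membership.Propositional using (_∈_)
open import Data.List.Membership.Propositional.Properties
  using (∈-map⁺; ∈-map⁻; ∈-filter⁺; ∈-filter⁻; ∈-upTo⁺; ∈-upTo⁻; ∈-++⁺ˡ; ∈-++⁺ʳ; ∈-++⁻;
         ∈-cartesianProduct⁺; ∈-cartesianProduct⁻)
open import Data.List.Membership.Setoid.Properties using (unique⇒irrelevant)
open import Data.List.Relation.Binary.BagAndSetEquality using (∼bag⇒↭)
open import Data.List.Relation.Binary.Permutation.Propositional using (_↭_)
open import Data.List.Relation.Binary.Permutation.Propositional.Properties using (↭-length)
import Data.List.Relation.Unary.All as All
open import Data.List.Relation.Unary.Any using (here; there)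
open import Data.List.Relation.Unary.Unique.Propositional using (Unique; _∷_)
import Data.List.Relation.Unary.Unique.Propositional.Properties as Unique
open import Data.Nat
  using (ℕ; zero; suc; _+_; _*_; _∸_; _≤_; _<_; z≤n; s≤s; z<s; NonZero; >-nonZero; >-nonZero⁻¹; ≢-nonZero⁻¹)
open import Data.Nat.DivMod using (_/_; m*n/n≡m; m*[n/m]≡n)
open import Data.Nat.Divisibility using (_∣_; _∣?_; ∣⇒≤; 0∣⇒≡0; m∣m*n)
open import Data.Nat.ListAction using (sum)
open import Data.Nat.Properties
open import Data.Nat.Tactic.RingSolver using (solve)
open import Data.Product using (_×_; _,_; proj₁; proj₂)
open import Data.Product.Properties using (≡-dec)
open import Data.Sum using (inj₁; inj₂)
open import Axiom.UniquenessOfIdentityProofs using (module Decidable⇒UIP)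
open import Function using (_∘_; id)
open import Function.Bundles using (mk↔ₛ′)
open import Level using (0ℓ)
open import Relation.Binary.Definitions using (DecidableEquality)
open import Relation.Binary.PropositionalEquality
open import Relation.Nullary using (¬_; yes; no; contradiction)
open import Relation.Unary using (Pred; Decidable; _⊆_; _≐_; _⟨×⟩_; ∁)
open import Relation.Unary.Properties using (∁?)

-- Counting by bijections

record Enumerates {A : Set} (P : Pred A 0ℓ) (xs : List A) : Set where
  field
    unique   : Unique xs
    sound    : ∀ {x} → x ∈ xs → P x
    complete : ∀ {x} → P x → x ∈ xs
open Enumerates

module _ {A : Set} where

  enumerates-resp-≐ : ∀ {P Q : Pred A 0ℓ} {xs} → P ≐ Q → Enumerates P xs → Enumerates Q xs
  enumerates-resp-≐ (P⊆Q , Q⊆P) e = record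
    { unique = unique e ; sound = P⊆Q ∘ sound e ; complete = complete e ∘ Q⊆P }

  filter-enumerates : ∀ {P Q : Pred A 0ℓ} {xs} (Q? : Decidable Q) →
                      Enumerates P xs → Enumerates (λ x → P x × Q x) (filter Q? xs)
  filter-enumerates Q? e = record
    { unique   = Unique.filter⁺ Q? (unique e)
    ; sound    = λ x∈ → let x∈xs , qx = ∈-filter⁻ Q? x∈ in sound e x∈xs , qx
    ; complete = λ (px , qx) → ∈-filter⁺ Q? (complete e px) qx
    }

  length-filter-split : ∀ {P : Pred A 0ℓ} (P? : Decidable P) xs →
                        length xs ≡ length (filter P? xs) + length (filter (∁? P?) xs)
  length-filter-split P? [] = refl
  length-filter-split P? (x ∷ xs) with P? x
  ... | yes _ = cong suc (length-filter-split P? xs)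
  ... | no  _ = trans (cong suc (length-filter-split P? xs)) (sym (+-suc _ _))

  -- Decidable equality gives UIP, so membership in a duplicate-free list is
  -- proof-irrelevant and the two inclusions are mutually inverse.
  unique-same-elements⇒↭ : DecidableEquality A → ∀ {xs ys : List A} → Unique xs → Unique ys →
                          (∀ {x} → x ∈ xs → x ∈ ys) → (∀ {x} → x ∈ ys → x ∈ xs) → xs ↭ ys
  unique-same-elements⇒↭ _≟_ xs! ys! to from =
    ∼bag⇒↭ (mk↔ₛ′ to from (λ p → irrelevant ys! _ p) (λ p → irrelevant xs! _ p))
    where irrelevant = unique⇒irrelevant (setoid A) (Decidable⇒UIP.≡-irrelevant _≟_)

module _ {A B : Set} {P : Pred A 0ℓ} {Q : Pred B 0ℓ} {xs : List A} {ys : List B} where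

  length-≡-by-bijection : DecidableEquality B → Enumerates P xs → Enumerates Q ys →
    (f : A → B) (g : B → A) → (∀ {x} → P x → Q (f x)) → (∀ {y} → Q y → P (g y)) →
    (∀ {x} → P x → g (f x) ≡ x) → (∀ {y} → Q y → f (g y) ≡ y) → length xs ≡ length ys
  length-≡-by-bijection _≟_ P-xs Q-ys f g f-Q g-P gf fg =
    trans (sym (length-map f xs)) (↭-length (unique-same-elements⇒↭ _≟_ fxs! (unique Q-ys) to from))
    where
    g∘f≗id : map g (map f xs) ≡ xs
    g∘f≗id = trans (sym (map-∘ xs)) (map-id-local (All.tabulate (gf ∘ sound P-xs)))
    fxs! : Unique (map f xs)
    fxs! = Unique.map⁻ (subst Unique (sym g∘f≗id) (unique P-xs))
    to : ∀ {y} → y ∈ map f xs → y ∈ ys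
    to y∈ with x , x∈ , refl ← ∈-map⁻ f y∈ = complete Q-ys (f-Q (sound P-xs x∈))
    from : ∀ {y} → y ∈ ys → y ∈ map f xs
    from y∈ = subst (_∈ map f xs) (fg (sound Q-ys y∈))
                    (∈-map⁺ f (complete P-xs (g-P (sound Q-ys y∈))))

upTo-enumerates : ∀ n → Enumerates (_< n) (upTo n)
upTo-enumerates n = record
  { unique = Unique.upTo⁺ n ; sound = ∈-upTo⁻ ; complete = ∈-upTo⁺ }

module _ {A B : Set} where

  cartesianProduct-enumerates : ∀ {P : Pred A 0ℓ} {Q : Pred B 0ℓ} {xs ys} →
    Enumerates P xs → Enumerates Q ys → Enumerates (P ⟨×⟩ Q) (cartesianProduct xs ys)
  cartesianProduct-enumerates {xs = xs} {ys} P-xs Q-ys = record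
    { unique   = Unique.cartesianProduct⁺ (unique P-xs) (unique Q-ys)
    ; sound    = λ p∈ → let x∈ , y∈ = ∈-cartesianProduct⁻ xs ys p∈ in sound P-xs x∈ , sound Q-ys y∈
    ; complete = λ (px , qy) → ∈-cartesianProduct⁺ (complete P-xs px) (complete Q-ys qy)
    }

  concatMap-map≡map-cartesianProduct : ∀ {C : Set} (h : A × B → C) xs ys →
    concatMap (λ x → map (λ y → h (x , y)) ys) xs ≡ map h (cartesianProduct xs ys)
  concatMap-map≡map-cartesianProduct h [] ys = refl
  concatMap-map≡map-cartesianProduct h (x ∷ xs) ys = begin
    map (λ y → h (x , y)) ys ++ concatMap (λ x → map (λ y → h (x , y)) ys) xs
      ≡⟨ cong₂ _++_ (map-∘ ys) (concatMap-map≡map-cartesianProduct h xs ys) ⟩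
    map h (map (x ,_) ys) ++ map h (cartesianProduct xs ys)
      ≡⟨ map-++ h (map (x ,_) ys) _ ⟨
    map h (cartesianProduct (x ∷ xs) ys) ∎
    where open ≡-Reasoning

  dependentProduct : List A → (A → List B) → List (A × B)
  dependentProduct xs f = concatMap (λ x → map (x ,_) (f x)) xs

  length-dependentProduct : ∀ xs (f : A → List B) →
                            length (dependentProduct xs f) ≡ sum (map (length ∘ f) xs)
  length-dependentProduct [] f = refl
  length-dependentProduct (x ∷ xs) f = begin
    length (map (x ,_) (f x) ++ dependentProduct xs f)
      ≡⟨ length-++ (map (x ,_) (f x)) ⟩
    length (map (x ,_) (f x)) + length (dependentProduct xs f)
      ≡⟨ cong₂ _+_ (length-map (x ,_) (f x)) (length-dependentProduct xs f) ⟩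
    length (f x) + sum (map (length ∘ f) xs) ∎
    where open ≡-Reasoning

  ∈-dependentProduct⁺ : ∀ {xs f x y} → x ∈ xs → y ∈ f x → (x , y) ∈ dependentProduct xs f
  ∈-dependentProduct⁺ (here refl) y∈ = ∈-++⁺ˡ (∈-map⁺ _ y∈)
  ∈-dependentProduct⁺ {x′ ∷ _} {f} (there x∈) y∈ =
    ∈-++⁺ʳ (map (x′ ,_) (f x′)) (∈-dependentProduct⁺ x∈ y∈)

  ∈-dependentProduct⁻ : ∀ xs {f x y} → (x , y) ∈ dependentProduct xs f → x ∈ xs × y ∈ f x
  ∈-dependentProduct⁻ (x′ ∷ xs) {f} p with ∈-++⁻ (map (x′ ,_) (f x′)) p
  ... | inj₁ q with y , y∈ , refl ← ∈-map⁻ (x′ ,_) q = here refl , y∈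
  ... | inj₂ q = let x∈ , y∈ = ∈-dependentProduct⁻ xs q in there x∈ , y∈

  dependentProduct⁺ : ∀ {xs} {f : A → List B} → Unique xs → (∀ x → Unique (f x)) →
                      Unique (dependentProduct xs f)
  dependentProduct⁺ {[]} _ _ = Unique.[]
  dependentProduct⁺ {x ∷ xs} {f} (x∉xs ∷ xs!) f! =
    Unique.++⁺ (Unique.map⁺ (cong proj₂) (f! x)) (dependentProduct⁺ xs! f!) disjoint
    where
    disjoint : ∀ {p} → ¬ (p ∈ map (x ,_) (f x) × p ∈ dependentProduct xs f)
    disjoint (p∈ , p∈′) with y , _ , refl ← ∈-map⁻ (x ,_) p∈ =
      All.lookup x∉xs (proj₁ (∈-dependentProduct⁻ xs p∈′)) refl

  dependentProduct-enumerates : ∀ {P : Pred A 0ℓ} {Q : A → Pred B 0ℓ} {xs f} →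
    Enumerates P xs → (∀ x → Enumerates (Q x) (f x)) →
    Enumerates (λ p → P (proj₁ p) × Q (proj₁ p) (proj₂ p)) (dependentProduct xs f)
  dependentProduct-enumerates {xs = xs} P-xs Q-f = record
    { unique   = dependentProduct⁺ (unique P-xs) (unique ∘ Q-f)
    ; sound    = λ p∈ → let x∈ , y∈ = ∈-dependentProduct⁻ xs p∈ in sound P-xs x∈ , sound (Q-f _) y∈
    ; complete = λ (px , qy) → ∈-dependentProduct⁺ (complete P-xs px) (complete (Q-f _) qy)
    }

factors≤ : ∀ {m n o} → 0 < m → 0 < n → m * n ≤ o → m ≤ o × n ≤ o
factors≤ {m} {n} 0<m 0<n mn≤o =
  ≤-trans (m≤m*n m n {{>-nonZero 0<n}}) mn≤o , ≤-trans (m≤n*m n m {{>-nonZero 0<m}}) mn≤o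

cofactor : ℕ → ℕ → ℕ
cofactor n zero = 0
cofactor n m@(suc _) = n / m

*-cofactor : ∀ {m n} → m ∣ n → m * cofactor n m ≡ n
*-cofactor {zero} 0∣n = sym (0∣⇒≡0 0∣n)
*-cofactor {suc _} m∣n = m*[n/m]≡n m∣n

cofactor-unique : ∀ {m k n} → 0 < m → m * k ≡ n → cofactor n m ≡ k
cofactor-unique {m@(suc _)} {k} _ refl = trans (cong (_/ m) (*-comm m k)) (m*n/n≡m k m)

positive-factorʳ : ∀ m {n o} → 0 < o → m * n ≡ o → 0 < n
positive-factorʳ m {zero} 0<o m0≡o = contradiction (trans (sym (*-zeroʳ m)) m0≡o) (<⇒≢ 0<o)
positive-factorʳ _ {suc _} _ _ = z<s

Box : ℕ → Pred Quad 0ℓ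
Box N = (_< N) ⟨×⟩ (_< N) ⟨×⟩ (_< N) ⟨×⟩ (_< N)

quads≡cartesianProduct : ∀ N → let U = upTo N in
  quads N ≡ cartesianProduct U (cartesianProduct U (cartesianProduct U U))
quads≡cartesianProduct N = begin
  quads N
    ≡⟨ concatMap-cong (λ x → concatMap-cong (λ y →
         concatMap-map≡map-cartesianProduct (λ t → x , y , t) U U) U) U ⟩
  concatMap (λ x → concatMap (λ y → map (λ t → x , y , t) (cartesianProduct U U)) U) U
    ≡⟨ concatMap-cong (λ x → concatMap-map≡map-cartesianProduct (x ,_) U _) U ⟩
  concatMap (λ x → map (x ,_) (cartesianProduct U (cartesianProduct U U))) U
    ≡⟨ concatMap-map≡map-cartesianProduct id U _ ⟩
  map id (cartesianProduct U (cartesianProduct U (cartesianProduct U U)))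
    ≡⟨ map-id _ ⟩
  cartesianProduct U (cartesianProduct U (cartesianProduct U U)) ∎
  where
  open ≡-Reasoning
  U = upTo N

quads-enumerates : ∀ N → Enumerates (Box N) (quads N)
quads-enumerates N = subst (Enumerates (Box N)) (sym (quads≡cartesianProduct N))
  (cartesianProduct-enumerates U (cartesianProduct-enumerates U (cartesianProduct-enumerates U U)))
  where U = upTo-enumerates N

-- Orphans of positive determinant

Orphan⁺ : ℕ → Pred Quad 0ℓ
Orphan⁺ D (a , b , c , d) = c < a × b < d × a * d ≡ D + b * c

orphans : ℕ → List Quad
orphans D = filter (orphanWithDet? D) (quads (suc (D + D * D)))

orphanWithDet⇒Orphan⁺ : ∀ {D} → OrphanWithDet D ⊆ Orphan⁺ D
orphanWithDet⇒Orphan⁺ {x = a , b , c , d} (inj₂ (c<a , b<d) , ad≡D+bc) = c<a , b<d , ad≡D+bc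
orphanWithDet⇒Orphan⁺ {D} {a , b , c@(suc _) , d} (inj₁ (a<c , d<b) , ad≡D+bc) =
  contradiction ad≡D+bc (<⇒≢ (begin-strict
    a * d      ≤⟨ *-monoˡ-≤ d (<⇒≤ a<c) ⟩
    c * d      <⟨ *-monoʳ-< c d<b ⟩
    c * b      ≡⟨ *-comm c b ⟩
    b * c      ≤⟨ m≤n+m (b * c) D ⟩
    D + b * c  ∎))
  where open ≤-Reasoning

Orphan⁺⇒b+c<D : ∀ {D a b c d} → Orphan⁺ D (a , b , c , d) → b + c < D
Orphan⁺⇒b+c<D {D} {a} {b} {c} {d} (c<a , b<d , ad≡D+bc) = +-cancelʳ-≤ (b * c) (suc (b + c)) D (begin
  suc (b + c) + b * c  ≡⟨ solve (b ∷ c ∷ []) ⟩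
  suc c * suc b        ≤⟨ *-mono-≤ c<a b<d ⟩
  a * d                ≡⟨ ad≡D+bc ⟩
  D + b * c            ∎)
  where open ≤-Reasoning

Orphan⁺-bounded : ∀ {D} → Orphan⁺ D ⊆ Box (suc (D + D * D))
Orphan⁺-bounded {D} {a , b , c , d} o@(c<a , b<d , ad≡D+bc) =
  s≤s a≤ , s≤s (≤-trans b≤D (m≤m+n D _)) , s≤s (≤-trans c≤D (m≤m+n D _)) , s≤s d≤
  where
  b≤D : b ≤ D
  b≤D = ≤-trans (m≤m+n b c) (<⇒≤ (Orphan⁺⇒b+c<D o))
  c≤D : c ≤ D
  c≤D = ≤-trans (m≤n+m c b) (<⇒≤ (Orphan⁺⇒b+c<D o))
  ad≤ : a * d ≤ D + D * D
  ad≤ = subst (_≤ D + D * D) (sym ad≡D+bc) (+-monoʳ-≤ D (*-mono-≤ b≤D c≤D))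
  a≤ = proj₁ (factors≤ (≤-<-trans z≤n c<a) (≤-<-trans z≤n b<d) ad≤)
  d≤ = proj₂ (factors≤ (≤-<-trans z≤n c<a) (≤-<-trans z≤n b<d) ad≤)

orphans-enumerates : ∀ D → Enumerates (Orphan⁺ D) (orphans D)
orphans-enumerates D = enumerates-resp-≐ (orphanWithDet⇒Orphan⁺ ∘ proj₂ , from)
  (filter-enumerates (orphanWithDet? D) (quads-enumerates (suc (D + D * D))))
  where
  from : ∀ {q} → Orphan⁺ D q → Box (suc (D + D * D)) q × OrphanWithDet D q
  from {a , b , c , d} o@(c<a , b<d , ad≡D+bc) = Orphan⁺-bounded o , inj₂ (c<a , b<d) , ad≡D+bc

twoTypePartitions : ℕ → List Quad
twoTypePartitions D = filter (twoTypePartition? D) (quads (suc D))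

twoTypePartition-bounded : ∀ {D} → TwoTypePartition D ⊆ Box (suc D)
twoTypePartition-bounded {D} {p , q , m , n} ((0<q , q<p) , (0<m , 0<n) , mp+nq≡D) =
  s≤s (proj₂ m,p≤D) , s≤s (proj₂ n,q≤D) , s≤s (proj₁ m,p≤D) , s≤s (proj₁ n,q≤D)
  where
  m,p≤D = factors≤ 0<m (≤-<-trans z≤n q<p) (subst (m * p ≤_) mp+nq≡D (m≤m+n (m * p) (n * q)))
  n,q≤D = factors≤ 0<n 0<q (subst (n * q ≤_) mp+nq≡D (m≤n+m (n * q) (m * p)))

twoTypePartitions-enumerates : ∀ D → Enumerates (TwoTypePartition D) (twoTypePartitions D)
twoTypePartitions-enumerates D = enumerates-resp-≐ (proj₂ , λ t → twoTypePartition-bounded t , t)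
  (filter-enumerates (twoTypePartition? D) (quads-enumerates (suc D)))

divisors-enumerates : ∀ D → .{{NonZero D}} → Enumerates (_∣ D) (divisors D)
divisors-enumerates D = record
  { unique   = Unique.filter⁺ (_∣? D) (Unique.map⁺ suc-injective (Unique.upTo⁺ D))
  ; sound    = proj₂ ∘ ∈-filter⁻ (_∣? D) {xs = map suc (upTo D)}
  ; complete = complete′
  }
  where
  complete′ : ∀ {m} → m ∣ D → m ∈ divisors D
  complete′ {zero}  0∣D = contradiction (0∣⇒≡0 0∣D) (≢-nonZero⁻¹ D)
  complete′ {suc _} m∣D = ∈-filter⁺ (_∣? D) (∈-map⁺ suc (∈-upTo⁺ (∣⇒≤ m∣D))) m∣D

DivisorPair : ℕ → Pred (ℕ × ℕ) 0ℓ
DivisorPair D (m , j) = m ∣ D × j < m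

divisorPairs : ℕ → List (ℕ × ℕ)
divisorPairs D = dependentProduct (divisors D) upTo

divisorPairs-enumerates : ∀ D → .{{NonZero D}} → Enumerates (DivisorPair D) (divisorPairs D)
divisorPairs-enumerates D = dependentProduct-enumerates (divisors-enumerates D) upTo-enumerates

length-divisorPairs : ∀ D → length (divisorPairs D) ≡ σ D
length-divisorPairs D = begin
  length (divisorPairs D)                         ≡⟨ length-dependentProduct (divisors D) upTo ⟩
  sum (map (length ∘ upTo) (divisors D))          ≡⟨ cong sum (map-cong length-upTo (divisors D)) ⟩
  sum (map id (divisors D))                       ≡⟨ cong sum (map-id (divisors D)) ⟩
  σ D                                             ∎
  where open ≡-Reasoning

-- Counting orphans by which of b and c vanish

ZeroB ZeroC : Pred Quad 0ℓ
ZeroB (_ , b , _ , _) = b ≡ 0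
ZeroC (_ , _ , c , _) = c ≡ 0

zeroB? : Decidable ZeroB
zeroB? (_ , b , _ , _) = b ≟ 0

zeroC? : Decidable ZeroC
zeroC? (_ , _ , c , _) = c ≟ 0

_≟-quad_ : DecidableEquality Quad
_≟-quad_ = ≡-dec _≟_ (≡-dec _≟_ (≡-dec _≟_ _≟_))

transpose : Quad → Quad
transpose (a , b , c , d) = d , c , b , a

Orphan⁺-transpose : ∀ {D} → Orphan⁺ D ⊆ Orphan⁺ D ∘ transpose
Orphan⁺-transpose {D} {a , b , c , d} (c<a , b<d , ad≡D+bc) =
  b<d , c<a , trans (*-comm d a) (trans ad≡D+bc (cong (D +_) (*-comm b c)))

toPartition : Quad → Quad
toPartition (a , b , c , d) = d , d ∸ b , a ∸ c , c

fromPartition : Quad → Quad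
fromPartition (p , q , m , n) = n + m , p ∸ q , n , p

-- Substituting a = c + x and d = b + y turns ad = D + bc into x d + c y = D.
det-identity : ∀ b c x y → (c + x) * (b + y) ≡ (x * (b + y) + c * y) + b * c
det-identity b c x y = solve (b ∷ c ∷ x ∷ y ∷ [])

det-equation⇒partition-equation : ∀ {D} b c x y → (c + x) * (b + y) ≡ D + b * c →
                                  x * (b + y) + c * y ≡ D
det-equation⇒partition-equation b c x y eq =
  +-cancelʳ-≡ (b * c) _ _ (trans (sym (det-identity b c x y)) eq)

partition-equation⇒det-equation : ∀ {D} b c x y → x * (b + y) + c * y ≡ D →
                                  (c + x) * (b + y) ≡ D + b * c
partition-equation⇒det-equation b c x y eq = trans (det-identity b c x y) (cong (_+ b * c) eq)

module _ (D : ℕ) .{{_ : NonZero D}} where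

  private
    0<D : 0 < D
    0<D = >-nonZero⁻¹ D

  Orphan⁺-zeroB⁻ : ∀ {a c d} → Orphan⁺ D (a , 0 , c , d) → c < a × a * d ≡ D
  Orphan⁺-zeroB⁻ (c<a , _ , ad≡D+0) = c<a , trans ad≡D+0 (+-identityʳ D)

  Orphan⁺-zeroB⁺ : ∀ {a c d} → c < a → a * d ≡ D → Orphan⁺ D (a , 0 , c , d)
  Orphan⁺-zeroB⁺ {a} c<a ad≡D = c<a , positive-factorʳ a 0<D ad≡D , trans ad≡D (sym (+-identityʳ D))

  length-orphans-zeroB : length (filter zeroB? (orphans D)) ≡ σ D
  length-orphans-zeroB = trans
    (length-≡-by-bijection (≡-dec _≟_ _≟_)
      (filter-enumerates zeroB? (orphans-enumerates D)) (divisorPairs-enumerates D)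
      toPair fromPair orphan→pair pair→orphan fromPair∘toPair (λ _ → refl))
    (length-divisorPairs D)
    where
    toPair : Quad → ℕ × ℕ
    toPair (a , _ , c , _) = a , c
    fromPair : ℕ × ℕ → Quad
    fromPair (m , j) = m , 0 , j , cofactor D m
    orphan→pair : ∀ {q} → Orphan⁺ D q × ZeroB q → DivisorPair D (toPair q)
    orphan→pair {a , _ , c , d} (o , refl) =
      let c<a , ad≡D = Orphan⁺-zeroB⁻ o in subst (a ∣_) ad≡D (m∣m*n d) , c<a
    pair→orphan : ∀ {p} → DivisorPair D p → Orphan⁺ D (fromPair p) × ZeroB (fromPair p)
    pair→orphan (m∣D , j<m) = Orphan⁺-zeroB⁺ j<m (*-cofactor m∣D) , refl
    fromPair∘toPair : ∀ {q} → Orphan⁺ D q × ZeroB q → fromPair (toPair q) ≡ q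
    fromPair∘toPair {a , _ , c , d} (o , refl) = let c<a , ad≡D = Orphan⁺-zeroB⁻ o in
      cong (λ k → a , 0 , c , k) (cofactor-unique (≤-<-trans z≤n c<a) ad≡D)

  length-orphans-zeroC : length (filter zeroC? (orphans D)) ≡ σ D
  length-orphans-zeroC = trans
    (length-≡-by-bijection _≟-quad_
      (filter-enumerates zeroC? (orphans-enumerates D)) (filter-enumerates zeroB? (orphans-enumerates D))
      transpose transpose zeroC→zeroB zeroB→zeroC (λ _ → refl) (λ _ → refl))
    length-orphans-zeroB
    where
    zeroC→zeroB : ∀ {q} → Orphan⁺ D q × ZeroC q → Orphan⁺ D (transpose q) × ZeroB (transpose q)
    zeroC→zeroB {_ , _ , _ , _} (o , c≡0) = Orphan⁺-transpose o , c≡0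
    zeroB→zeroC : ∀ {q} → Orphan⁺ D q × ZeroB q → Orphan⁺ D (transpose q) × ZeroC (transpose q)
    zeroB→zeroC {_ , _ , _ , _} (o , b≡0) = Orphan⁺-transpose o , b≡0

  length-orphans-zeroB-zeroC : length (filter zeroB? (filter zeroC? (orphans D))) ≡ τ D
  length-orphans-zeroB-zeroC =
    length-≡-by-bijection _≟_
      (filter-enumerates zeroB? (filter-enumerates zeroC? (orphans-enumerates D)))
      (divisors-enumerates D)
      proj₁ fromDivisor orphan→divisor divisor→orphan fromDivisor∘proj₁ (λ _ → refl)
    where
    fromDivisor : ℕ → Quad
    fromDivisor m = m , 0 , 0 , cofactor D m
    orphan→divisor : ∀ {q} → (Orphan⁺ D q × ZeroC q) × ZeroB q → proj₁ q ∣ D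
    orphan→divisor {a , _ , _ , d} ((o , refl) , refl) = subst (a ∣_) (proj₂ (Orphan⁺-zeroB⁻ o)) (m∣m*n d)
    divisor→orphan : ∀ {m} → m ∣ D → (Orphan⁺ D (fromDivisor m) × ZeroC (fromDivisor m)) × ZeroB (fromDivisor m)
    divisor→orphan {m} m∣D = (Orphan⁺-zeroB⁺ 0<m (*-cofactor m∣D) , refl) , refl
      where 0<m = positive-factorʳ (cofactor D m) 0<D (trans (*-comm (cofactor D m) m) (*-cofactor m∣D))
    fromDivisor∘proj₁ : ∀ {q} → (Orphan⁺ D q × ZeroC q) × ZeroB q → fromDivisor (proj₁ q) ≡ q
    fromDivisor∘proj₁ {a , _ , _ , d} ((o , refl) , refl) = let c<a , ad≡D = Orphan⁺-zeroB⁻ o in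
      cong (λ k → a , 0 , 0 , k) (cofactor-unique c<a ad≡D)

  length-orphans-nonzeroB-nonzeroC :
    length (filter (∁? zeroC?) (filter (∁? zeroB?) (orphans D))) ≡ ν₂ D
  length-orphans-nonzeroB-nonzeroC =
    length-≡-by-bijection _≟-quad_
      (filter-enumerates (∁? zeroC?) (filter-enumerates (∁? zeroB?) (orphans-enumerates D)))
      (twoTypePartitions-enumerates D)
      toPartition fromPartition orphan→partition partition→orphan from∘to to∘from
    where
    orphan→partition : ∀ {q} → (Orphan⁺ D q × ∁ ZeroB q) × ∁ ZeroC q →
                       TwoTypePartition D (toPartition q)
    orphan→partition {a , b , c , d} ((((c<a , b<d , ad≡D+bc) , b≢0) , c≢0)) =
      (m<n⇒0<n∸m b<d , ∸-monoʳ-< (n≢0⇒n>0 b≢0) (<⇒≤ b<d)) , (m<n⇒0<n∸m c<a , n≢0⇒n>0 c≢0) ,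
      subst (λ d′ → (a ∸ c) * d′ + c * (d ∸ b) ≡ D) b+[d∸b]≡d
        (det-equation⇒partition-equation b c (a ∸ c) (d ∸ b)
          (subst₂ (λ a′ d′ → a′ * d′ ≡ D + b * c) (sym (m+[n∸m]≡n (<⇒≤ c<a))) (sym b+[d∸b]≡d) ad≡D+bc))
      where b+[d∸b]≡d = m+[n∸m]≡n (<⇒≤ b<d)
    partition→orphan : ∀ {t} → TwoTypePartition D t →
                       (Orphan⁺ D (fromPartition t) × ∁ ZeroB (fromPartition t)) × ∁ ZeroC (fromPartition t)
    partition→orphan {p , q , m , n} ((0<q , q<p) , (0<m , 0<n) , mp+nq≡D) =
      ((m<m+n n 0<m , ∸-monoʳ-< 0<q (<⇒≤ q<p) ,
        subst (λ p′ → (n + m) * p′ ≡ D + (p ∸ q) * n) p∸q+q≡p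
          (partition-equation⇒det-equation (p ∸ q) n m q
            (subst (λ p′ → m * p′ + n * q ≡ D) (sym p∸q+q≡p) mp+nq≡D))) ,
       m>n⇒m∸n≢0 q<p) , n>0⇒n≢0 0<n
      where p∸q+q≡p = m∸n+n≡m (<⇒≤ q<p)
    from∘to : ∀ {q} → (Orphan⁺ D q × ∁ ZeroB q) × ∁ ZeroC q → fromPartition (toPartition q) ≡ q
    from∘to {a , b , c , d} (((c<a , b<d , _) , _) , _) =
      cong₂ (λ a′ b′ → a′ , b′ , c , d) (m+[n∸m]≡n (<⇒≤ c<a)) (m∸[m∸n]≡n (<⇒≤ b<d))
    to∘from : ∀ {t} → TwoTypePartition D t → toPartition (fromPartition t) ≡ t
    to∘from {p , q , m , n} ((_ , q<p) , _) =
      cong₂ (λ q′ m′ → p , q′ , m′ , n) (m∸[m∸n]≡n (<⇒≤ q<p)) (m+n∸m≡n n m)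

  length-orphans-nonzeroB-zeroC :
    length (filter zeroC? (filter (∁? zeroB?) (orphans D))) ≡
    length (filter (∁? zeroB?) (filter zeroC? (orphans D)))
  length-orphans-nonzeroB-zeroC =
    length-≡-by-bijection _≟-quad_
      (filter-enumerates zeroC? (filter-enumerates (∁? zeroB?) (orphans-enumerates D)))
      (filter-enumerates (∁? zeroB?) (filter-enumerates zeroC? (orphans-enumerates D)))
      id id (λ ((o , b≢0) , c≡0) → (o , c≡0) , b≢0) (λ ((o , c≡0) , b≢0) → (o , b≢0) , c≡0)
      (λ _ → refl) (λ _ → refl)

proposition2p1 : (D : ℕ) → .{{_ : NonZero D}} → h D + τ D ≡ ν₂ D + 2 * σ D
proposition2p1 D = combine h≡ σ≡
  where
  O = orphans D
  nonzeroB-zeroC = length (filter zeroC? (filter (∁? zeroB?) O))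

  h≡ : h D ≡ σ D + (nonzeroB-zeroC + ν₂ D)
  h≡ = begin
    h D
      ≡⟨ length-filter-split zeroB? O ⟩
    length (filter zeroB? O) + length (filter (∁? zeroB?) O)
      ≡⟨ cong₂ _+_ (length-orphans-zeroB D) (length-filter-split zeroC? (filter (∁? zeroB?) O)) ⟩
    σ D + (nonzeroB-zeroC + length (filter (∁? zeroC?) (filter (∁? zeroB?) O)))
      ≡⟨ cong (λ n → σ D + (nonzeroB-zeroC + n)) (length-orphans-nonzeroB-nonzeroC D) ⟩
    σ D + (nonzeroB-zeroC + ν₂ D) ∎
    where open ≡-Reasoning

  σ≡ : σ D ≡ τ D + nonzeroB-zeroC
  σ≡ = begin
    σ D
      ≡⟨ length-orphans-zeroC D ⟨
    length (filter zeroC? O)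
      ≡⟨ length-filter-split zeroB? (filter zeroC? O) ⟩
    length (filter zeroB? (filter zeroC? O)) + length (filter (∁? zeroB?) (filter zeroC? O))
      ≡⟨ cong₂ _+_ (length-orphans-zeroB-zeroC D) (sym (length-orphans-nonzeroB-zeroC D)) ⟩
    τ D + nonzeroB-zeroC ∎
    where open ≡-Reasoning

  combine : ∀ {h s t x v} → h ≡ s + (x + v) → s ≡ t + x → h + t ≡ v + 2 * s
  combine {t = t} {x} {v} refl refl = solve (t ∷ x ∷ v ∷ [])
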